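{- Let $n\geq 2$ and let $\mathcal{F}\subseteq 2^{[n]}$ be an induced-$\mathcal{D}_2$-saturated family in $\mathcal{B}_n$. If $\emptyset\in\mathcal{F}$ or $[n]\in\mathcal{F}$, then $|\mathcal{F}|\geq n+1$.
   Context: $\mathcal{D}_2$ (the diamond) is the four-element poset $\{a,b,c,d\}$ with $a<b<d$, $a<c<d$ and $b,c$ incomparable. $\mathcal{B}_n$ is the Boolean lattice $(2^{[n]},\subseteq)$. A poset $\mathcal{P}'=(P',\le')$ is an induced subposet of $\mathcal{P}=(P,\le)$ if there is an injection $f:P'\to P$ with $u\le' v$ iff $f(u)\le f(v)$. A family $\mathcal{F}\subseteq 2^{[n]}$ (ordered by inclusion) is induced-$\mathcal{P}$-saturated in $\mathcal{B}_n$ if it contains no induced copy of $\mathcal{P}$, but every $\mathcal{F}'$ with $\mathcal{F}\subsetneq\mathcal{F}'\subseteq 2^{[n]}$ contains an induced copy of $\mathcal{P}$. -}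

module Defs where

open import Data.Nat using (ℕ; zero; suc; _+_)
open import Data.Bool using (Bool; true; false; if_then_else_)
open import Data.Fin using (Fin)
open import Data.Fin.Subset using (Subset; _⊆_; ⊥; ⊤)
open import Data.Vec using (Vec; []; _∷_)
open import Data.List using (List; []; _∷_; map; _++_; length; filter)
open import Data.Product using (Σ; ∃; _×_; _,_)
open import Function.Bundles using (_⇔_)
open import Relation.Binary.PropositionalEquality using (_≡_)
open import Relation.Nullary using (¬_)
open import Data.Bool.Properties using (T?)
open import Data.Bool using (T)

Family : ℕ → Set
Family n = Subset n → Bool

_∈F_ : {n : ℕ} → Subset n → Family n → Set
s ∈F F = F s ≡ true

allSubsets : (n : ℕ) → List (Subset n)
allSubsets zero = [] ∷ []
allSubsets (suc n) = map (false ∷_) (allSubsets n) ++ map (true ∷_) (allSubsets n)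

card : {n : ℕ} → Family n → ℕ
card {n} F = length (filter (λ s → T? (F s)) (allSubsets n))

-- The diamond D₂ on Fin 4: 0 = a, 1 = b, 2 = c, 3 = d.
data _≤D_ : Fin 4 → Fin 4 → Set where
  refl≤ : ∀ {x} → x ≤D x
  a≤b : Fin.zero ≤D Fin.suc Fin.zero
  a≤c : Fin.zero ≤D Fin.suc (Fin.suc Fin.zero)
  a≤d : Fin.zero ≤D Fin.suc (Fin.suc (Fin.suc Fin.zero))
  b≤d : Fin.suc Fin.zero ≤D Fin.suc (Fin.suc (Fin.suc Fin.zero))
  c≤d : Fin.suc (Fin.suc Fin.zero) ≤D Fin.suc (Fin.suc (Fin.suc Fin.zero))

HasInducedD₂ : {n : ℕ} → Family n → Set
HasInducedD₂ {n} F =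
  Σ (Fin 4 → Subset n) λ f →
    (∀ u → f u ∈F F) ×
    (∀ u v → f u ≡ f v → u ≡ v) ×
    (∀ u v → (u ≤D v) ⇔ (f u ⊆ f v))

_⊆F_ : {n : ℕ} → Family n → Family n → Set
F ⊆F G = ∀ s → s ∈F F → s ∈F G

InducedD₂Saturated : {n : ℕ} → Family n → Set
InducedD₂Saturated {n} F =
  ¬ HasInducedD₂ F ×
  (∀ (G : Family n) → F ⊆F G → (∃ λ s → s ∈F G × ¬ (s ∈F F)) → HasInducedD₂ G)

-- By complementation it suffices to treat ∅ ∈ 𝓕. Then 𝓕 contains no two incomparable
-- sets below a common member, since together with ∅ they would form a diamond; and
-- adding any set S ∉ 𝓕 must create such a "wedge" with S as one of its three sets.
-- For every point i choose, among the inclusion-minimal members of 𝓕 containing i,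
-- one with the most members of 𝓕 strictly below it. If the same set m were chosen for
-- two points i ≠ j, let p be the largest member strictly below m and S = p ∪ {i}:
-- S ∉ 𝓕 lies strictly below m, so it sits beside some e in a wedge with top t, and a
-- minimal member containing i below t then lies strictly above e ⊋ p and is deeper
-- than m. Hence ∅ and the n chosen sets are n + 1 distinct members of 𝓕.
module Submission where

open import Defs
open import Data.Nat using (ℕ; _≤_; _+_)
open import Data.Fin.Subset using (⊥; ⊤)
open import Data.Sum using (_⊎_)

open import Algebra.Lattice.Properties.BooleanAlgebra as BooleanAlgebra using ()
open import Data.Bool using (true; false; _∨_; T)
open import Data.Bool.Properties using (T?) renaming (_≟_ to _≟ᵇ_)
open import Data.Empty using (⊥-elim)
open import Data.Fin using (Fin; zero; suc)
open import Data.Fin.Properties using (injective⇒≤) renaming (_≟_ to _≟ᶠ_)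
open import Data.Fin.Subset using (Subset; _⊆_; _∈_; _∉_; ⁅_⁆; _∪_; ∁)
open import Data.Fin.Subset.Properties
  using (_⊆?_; _∈?_; ⊆-refl; ⊆-trans; ⊆-antisym; ⊆-reflexive; ⊥⊆; ∉⊥; x∈⁅x⁆; x∈⁅y⁆⇒x≡y;
         p⊆p∪q; q⊆p∪q; x∈p∪q⁻; p⊆q⇒∁p⊇∁q; ∁p⊆∁q⇒p⊇q; anySubset?; ∪-∩-booleanAlgebra)
open import Data.List using (List; []; _∷_; map; _++_; filter; length; lookup)
open import Data.List.Extrema.Nat
  using (argmax; argmin; argmax-all; argmin-all; f[xs]≤f[argmax]; f[argmin]≤f[xs])
open import Data.List.Membership.Propositional using () renaming (_∈_ to _∈ₗ_)
open import Data.List.Membership.Propositional.Properties using (∈-map⁺; ∈-++⁺ˡ; ∈-++⁺ʳ; ∈-filter⁺)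
open import Data.List.Properties using (length-filter; filter-notAll; filter-reject)
open import Data.List.Relation.Unary.All as All using ()
open import Data.List.Relation.Unary.All.Properties using (all-filter)
open import Data.List.Relation.Unary.Any as Any using (here; index)
open import Data.List.Relation.Unary.Any.Properties using (lookup-index)
open import Data.Nat using (zero; suc; _<_)
open import Data.Nat.Properties using (≤-<-trans; <⇒≱; +-comm)
open import Data.Product using (Σ; ∃; ∃₂; _×_; _,_; proj₁; proj₂)
open import Data.Sum using (inj₁; inj₂; [_,_]′)
open import Data.Vec using ([]; _∷_)
open import Data.Vec.Properties using (≡-dec)
open import Function using (_∘_)
open import Function.Bundles using (mk⇔; Equivalence)
open import Function.Definitions using (Injective)
open import Level using (0ℓ)
open import Relation.Binary.PropositionalEquality using (_≡_; _≢_; refl; sym; trans; cong; subst)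
open import Relation.Nullary using (¬_; Dec; yes; no; does; contradiction)
open import Relation.Nullary.Decidable using (_×-dec_; ¬?)
open import Relation.Unary using (Pred; Decidable)

module _ {A : Set} {P Q : Pred A 0ℓ} (P? : Decidable P) (Q? : Decidable Q)
         (P⇒Q : ∀ {x} → P x → Q x) where

  filter-filter-⇒ : ∀ xs → filter P? (filter Q? xs) ≡ filter P? xs
  filter-filter-⇒ [] = refl
  filter-filter-⇒ (x ∷ xs) with Q? x
  ... | yes _ with P? x
  ...   | yes _ = cong (x ∷_) (filter-filter-⇒ xs)
  ...   | no _  = filter-filter-⇒ xs
  filter-filter-⇒ (x ∷ xs) | no ¬qx =
    trans (filter-filter-⇒ xs) (sym (filter-reject P? (¬qx ∘ P⇒Q)))

  length-filter-mono : ∀ xs → length (filter P? xs) ≤ length (filter Q? xs)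
  length-filter-mono xs =
    subst (_≤ _) (cong length (filter-filter-⇒ xs)) (length-filter P? (filter Q? xs))

  length-filter-mono-< : ∀ {x xs} → x ∈ₗ xs → Q x → ¬ P x →
                         length (filter P? xs) < length (filter Q? xs)
  length-filter-mono-< {xs = xs} x∈xs qx ¬px =
    subst (_< _) (cong length (filter-filter-⇒ xs))
      (filter-notAll P? (filter Q? xs) (Any.map (λ { refl → ¬px }) (∈-filter⁺ Q? x∈xs qx)))

module _ {A : Set} {xs : List A} (complete : ∀ x → x ∈ₗ xs) (f : A → ℕ)
         {P : Pred A 0ℓ} (P? : Decidable P) where

  maximiser : Σ A P → Σ A λ x → P x × (∀ y → P y → f y ≤ f x)
  maximiser (w , pw) =
    argmax f w ys , argmax-all f pw (all-filter P? xs) ,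
    λ y py → All.lookup (f[xs]≤f[argmax] w ys) (∈-filter⁺ P? (complete y) py)
    where
    ys : List A
    ys = filter P? xs

  minimiser : Σ A P → Σ A λ x → P x × (∀ y → P y → f x ≤ f y)
  minimiser (w , pw) =
    argmin f w ys , argmin-all f pw (all-filter P? xs) ,
    λ y py → All.lookup (f[argmin]≤f[xs] w ys) (∈-filter⁺ P? (complete y) py)
    where
    ys : List A
    ys = filter P? xs

allSubsets-complete : ∀ {n} (s : Subset n) → s ∈ₗ allSubsets n
allSubsets-complete {zero} [] = here refl
allSubsets-complete {suc n} (false ∷ s) = ∈-++⁺ˡ (∈-map⁺ (false ∷_) (allSubsets-complete s))
allSubsets-complete {suc n} (true ∷ s) =
  ∈-++⁺ʳ (map (false ∷_) (allSubsets n)) (∈-map⁺ (true ∷_) (allSubsets-complete s))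

module _ {n : ℕ} where

  _≟ˢ_ : (x y : Subset n) → Dec (x ≡ y)
  _≟ˢ_ = ≡-dec _≟ᵇ_

  _∈F?_ : (s : Subset n) (F : Family n) → Dec (s ∈F F)
  s ∈F? F = F s ≟ᵇ true

  open BooleanAlgebra (∪-∩-booleanAlgebra n) using (¬⊥≈⊤) renaming (¬-involutive to ∁-involutive)

  ∁⊥≡⊤ : ∁ ⊥ ≡ ⊤
  ∁⊥≡⊤ = ¬⊥≈⊤

  ∁-injective : Injective _≡_ _≡_ (∁ {n})
  ∁-injective {x} {y} ∁x≡∁y = trans (sym (∁-involutive x)) (trans (cong ∁ ∁x≡∁y) (∁-involutive y))

  infix 4 _⊊_
  _⊊_ : Subset n → Subset n → Set
  x ⊊ y = x ⊆ y × x ≢ y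

  _⊊?_ : (x y : Subset n) → Dec (x ⊊ y)
  x ⊊? y = (x ⊆? y) ×-dec ¬? (x ≟ˢ y)

  ⊆-⊊-trans : ∀ {x y z} → x ⊆ y → y ⊊ z → x ⊊ z
  ⊆-⊊-trans x⊆y (y⊆z , y≢z) =
    ⊆-trans x⊆y y⊆z , λ { refl → y≢z (⊆-antisym y⊆z x⊆y) }

  ⊆⁅⁆-total : ∀ {i} {b c : Subset n} → b ⊆ ⁅ i ⁆ → c ⊆ ⁅ i ⁆ → b ⊆ c ⊎ c ⊆ b
  ⊆⁅⁆-total {i} {c = c} b⊆i c⊆i with i ∈? c
  ... | yes i∈c = inj₁ λ x∈b → subst (_∈ c) (sym (x∈⁅y⁆⇒x≡y i (b⊆i x∈b))) i∈c
  ... | no i∉c  = inj₂ λ x∈c → contradiction (subst (_∈ c) (x∈⁅y⁆⇒x≡y i (c⊆i x∈c)) x∈c) i∉c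

  x∈p∪⁅x⁆ : ∀ (p : Subset n) x → x ∈ p ∪ ⁅ x ⁆
  x∈p∪⁅x⁆ p x = q⊆p∪q p ⁅ x ⁆ (x∈⁅x⁆ x)

  p∪⁅x⁆-least : ∀ {p q : Subset n} {x} → p ⊆ q → x ∈ q → p ∪ ⁅ x ⁆ ⊆ q
  p∪⁅x⁆-least {p} {q} {x} p⊆q x∈q y∈p∪x with x∈p∪q⁻ p ⁅ x ⁆ y∈p∪x
  ... | inj₁ y∈p = p⊆q y∈p
  ... | inj₂ y∈x = subst (_∈ q) (sym (x∈⁅y⁆⇒x≡y x y∈x)) x∈q

  y∉p∪⁅x⁆ : ∀ {p : Subset n} {x y} → y ∉ p → y ≢ x → y ∉ p ∪ ⁅ x ⁆
  y∉p∪⁅x⁆ {p} {x} y∉p y≢x y∈p∪x = [ y∉p , y≢x ∘ x∈⁅y⁆⇒x≡y x ]′ (x∈p∪q⁻ p ⁅ x ⁆ y∈p∪x)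

  Incomparable : Subset n → Subset n → Set
  Incomparable x y = ¬ x ⊆ y × ¬ y ⊆ x

  Wedge : Subset n → Subset n → Subset n → Set
  Wedge b c t = b ⊆ t × c ⊆ t × Incomparable b c

  wedge-sym : ∀ {b c t} → Wedge b c t → Wedge c b t
  wedge-sym (b⊆t , c⊆t , b⊈c , c⊈b) = c⊆t , b⊆t , c⊈b , b⊈c

  Diamond : Subset n → Subset n → Subset n → Subset n → Set
  Diamond a b c d = a ⊆ b × a ⊆ c × Wedge b c d

  record DiamondIn (F : Family n) : Set where
    constructor diamond
    field
      a b c d : Subset n
      a∈F : a ∈F F
      b∈F : b ∈F F
      c∈F : c ∈F F
      d∈F : d ∈F F
      shape : Diamond a b c d

  ≤D-antisym : ∀ {u v} → u ≤D v → v ≤D u → u ≡ v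
  ≤D-antisym refl≤ _ = refl

  diamond⇒induced : ∀ {F} → DiamondIn F → HasInducedD₂ F
  diamond⇒induced {F} (diamond a b c d a∈F b∈F c∈F d∈F (a⊆b , a⊆c , b⊆d , c⊆d , b⊈c , c⊈b)) =
    f , f∈F , injective , λ u v → mk⇔ monotone (reflecting u v)
    where
    f : Fin 4 → Subset n
    f zero = a
    f (suc zero) = b
    f (suc (suc zero)) = c
    f (suc (suc (suc zero))) = d
    f∈F : ∀ u → f u ∈F F
    f∈F zero = a∈F
    f∈F (suc zero) = b∈F
    f∈F (suc (suc zero)) = c∈F
    f∈F (suc (suc (suc zero))) = d∈F
    monotone : ∀ {u v} → u ≤D v → f u ⊆ f v
    monotone refl≤ = ⊆-refl
    monotone a≤b = a⊆b
    monotone a≤c = a⊆c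
    monotone a≤d = ⊆-trans a⊆b b⊆d
    monotone b≤d = b⊆d
    monotone c≤d = c⊆d
    reflecting : ∀ u v → f u ⊆ f v → u ≤D v
    reflecting zero zero _ = refl≤
    reflecting zero (suc zero) _ = a≤b
    reflecting zero (suc (suc zero)) _ = a≤c
    reflecting zero (suc (suc (suc zero))) _ = a≤d
    reflecting (suc zero) (suc zero) _ = refl≤
    reflecting (suc zero) (suc (suc (suc zero))) _ = b≤d
    reflecting (suc (suc zero)) (suc (suc zero)) _ = refl≤
    reflecting (suc (suc zero)) (suc (suc (suc zero))) _ = c≤d
    reflecting (suc (suc (suc zero))) (suc (suc (suc zero))) _ = refl≤
    reflecting (suc zero) zero b⊆a = ⊥-elim (b⊈c (⊆-trans b⊆a a⊆c))
    reflecting (suc zero) (suc (suc zero)) b⊆c = ⊥-elim (b⊈c b⊆c)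
    reflecting (suc (suc zero)) zero c⊆a = ⊥-elim (c⊈b (⊆-trans c⊆a a⊆b))
    reflecting (suc (suc zero)) (suc zero) c⊆b = ⊥-elim (c⊈b c⊆b)
    reflecting (suc (suc (suc zero))) zero d⊆a = ⊥-elim (c⊈b (⊆-trans c⊆d (⊆-trans d⊆a a⊆b)))
    reflecting (suc (suc (suc zero))) (suc zero) d⊆b = ⊥-elim (c⊈b (⊆-trans c⊆d d⊆b))
    reflecting (suc (suc (suc zero))) (suc (suc zero)) d⊆c = ⊥-elim (b⊈c (⊆-trans b⊆d d⊆c))
    injective : ∀ u v → f u ≡ f v → u ≡ v
    injective u v fu≡fv = ≤D-antisym (reflecting u v (⊆-reflexive fu≡fv))
                                     (reflecting v u (⊆-reflexive (sym fu≡fv)))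

  induced⇒diamond : ∀ {F} → HasInducedD₂ F → DiamondIn F
  induced⇒diamond (f , f∈F , _ , embeds) =
    diamond (f a) (f b) (f c) (f d) (f∈F a) (f∈F b) (f∈F c) (f∈F d)
      (mono a≤b , mono a≤c , mono b≤d , mono c≤d , ¬b≤c ∘ reflect b c , ¬c≤b ∘ reflect c b)
    where
    a b c d : Fin 4
    a = zero
    b = suc zero
    c = suc (suc zero)
    d = suc (suc (suc zero))
    mono : ∀ {u v} → u ≤D v → f u ⊆ f v
    mono = Equivalence.to (embeds _ _)
    reflect : ∀ u v → f u ⊆ f v → u ≤D v
    reflect u v = Equivalence.from (embeds u v)
    ¬b≤c : ¬ b ≤D c
    ¬b≤c ()
    ¬c≤b : ¬ c ≤D b
    ¬c≤b ()

  diamond-∁ : ∀ {F} → DiamondIn (F ∘ ∁) → DiamondIn F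
  diamond-∁ (diamond a b c d a∈F b∈F c∈F d∈F (a⊆b , a⊆c , b⊆d , c⊆d , b⊈c , c⊈b)) =
    diamond (∁ d) (∁ c) (∁ b) (∁ a) d∈F c∈F b∈F a∈F
      (p⊆q⇒∁p⊇∁q c⊆d , p⊆q⇒∁p⊇∁q b⊆d , p⊆q⇒∁p⊇∁q a⊆c , p⊆q⇒∁p⊇∁q a⊆b ,
       b⊈c ∘ ∁p⊆∁q⇒p⊇q , c⊈b ∘ ∁p⊆∁q⇒p⊇q)

  induced-∁ : ∀ {F} → HasInducedD₂ (F ∘ ∁) → HasInducedD₂ F
  induced-∁ {F} = diamond⇒induced ∘ diamond-∁ {F} ∘ induced⇒diamond

  ∁-saturated : ∀ {F} → InducedD₂Saturated F → InducedD₂Saturated (F ∘ ∁)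
  ∁-saturated {F} (F-free , F-maximal) =
    F-free ∘ induced-∁ {F} ,
    λ G F∘∁⊆G (s , s∈G , s∉F∘∁) →
      induced-∁ {G} (F-maximal (G ∘ ∁)
        (λ x x∈F → F∘∁⊆G (∁ x) (subst (_∈F F) (sym (∁-involutive x)) x∈F))
        (∁ s , subst (_∈F G) (sym (∁-involutive s)) s∈G , s∉F∘∁))

  insert : Subset n → Family n → Family n
  insert S F s = does (s ≟ˢ S) ∨ F s

  ∈-insert⁻ : ∀ {S F s} → s ∈F insert S F → s ≡ S ⊎ s ∈F F
  ∈-insert⁻ {S} {s = s} s∈ with s ≟ˢ S
  ... | yes s≡S = inj₁ s≡S
  ... | no _ = inj₂ s∈

  ∈-insert-new : ∀ {S F} → S ∈F insert S F
  ∈-insert-new {S} with S ≟ˢ S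
  ... | yes _ = refl
  ... | no S≢S = contradiction refl S≢S

  ⊆-insert : ∀ {S F} → F ⊆F insert S F
  ⊆-insert {S} s s∈F with s ≟ˢ S
  ... | yes _ = refl
  ... | no _ = s∈F

  _↪_ : ℕ → Family n → Set
  k ↪ F = Σ (Fin k → Subset n) λ h → (∀ x → h x ∈F F) × Injective _≡_ _≡_ h

  ↪-∁ : ∀ {k F} → k ↪ (F ∘ ∁) → k ↪ F
  ↪-∁ (h , h∈F , h-injective) = ∁ ∘ h , h∈F , h-injective ∘ ∁-injective

  ↪⇒≤card : ∀ {k F} → k ↪ F → k ≤ card F
  ↪⇒≤card {k} {F} (h , h∈F , h-injective) = injective⇒≤ (h-injective ∘ lookup-injective)
    where
    members : List (Subset n)
    members = filter (λ s → T? (F s)) (allSubsets n)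
    h∈members : ∀ x → h x ∈ₗ members
    h∈members x =
      ∈-filter⁺ (λ s → T? (F s)) (allSubsets-complete (h x)) (subst T (sym (h∈F x)) _)
    position : Fin k → Fin (length members)
    position x = index (h∈members x)
    lookup-injective : ∀ {x y} → position x ≡ position y → h x ≡ h y
    lookup-injective {x} {y} eq =
      trans (lookup-index (h∈members x))
            (trans (cong (lookup members) eq) (sym (lookup-index (h∈members y))))

module WithEmptySet {n : ℕ} {F : Family n} (⊥∈F : ⊥ ∈F F) (saturated : InducedD₂Saturated F) where

  no-wedge : ∀ {b c t} → b ∈F F → c ∈F F → t ∈F F → ¬ Wedge b c t
  no-wedge b∈F c∈F t∈F w =
    proj₁ saturated (diamond⇒induced (diamond ⊥ _ _ _ ⊥∈F b∈F c∈F t∈F (⊥⊆ , ⊥⊆ , w)))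

  comparable-below : ∀ {b c t} → b ∈F F → c ∈F F → t ∈F F → b ⊆ t → c ⊆ t → b ⊆ c ⊎ c ⊆ b
  comparable-below {b} {c} b∈F c∈F t∈F b⊆t c⊆t with b ⊆? c | c ⊆? b
  ... | yes b⊆c | _ = inj₁ b⊆c
  ... | no _ | yes c⊆b = inj₂ c⊆b
  ... | no b⊈c | no c⊈b = ⊥-elim (no-wedge b∈F c∈F t∈F (b⊆t , c⊆t , b⊈c , c⊈b))

  WedgeUnder WedgeBeside : Subset n → Set
  WedgeUnder S = ∃₂ λ b c → b ∈F F × c ∈F F × Wedge b c S
  WedgeBeside S = ∃₂ λ e t → e ∈F F × t ∈F F × Wedge S e t

  wedge-in-insert : ∀ {S b c d} → b ≡ S ⊎ b ∈F F → c ≡ S ⊎ c ∈F F → d ≡ S ⊎ d ∈F F →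
                    Wedge b c d → WedgeUnder S ⊎ WedgeBeside S
  wedge-in-insert (inj₂ b∈F) (inj₂ c∈F) (inj₂ d∈F) w = ⊥-elim (no-wedge b∈F c∈F d∈F w)
  wedge-in-insert (inj₂ b∈F) (inj₂ c∈F) (inj₁ refl) w = inj₁ (_ , _ , b∈F , c∈F , w)
  wedge-in-insert (inj₁ refl) (inj₂ c∈F) (inj₂ d∈F) w = inj₂ (_ , _ , c∈F , d∈F , w)
  wedge-in-insert (inj₂ b∈F) (inj₁ refl) (inj₂ d∈F) w = inj₂ (_ , _ , b∈F , d∈F , wedge-sym w)
  wedge-in-insert (inj₁ refl) (inj₁ refl) _ (_ , _ , b⊈b , _) = ⊥-elim (b⊈b ⊆-refl)
  wedge-in-insert (inj₁ refl) _ (inj₁ refl) (_ , c⊆b , _ , c⊈b) = ⊥-elim (c⊈b c⊆b)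
  wedge-in-insert _ (inj₁ refl) (inj₁ refl) (b⊆c , _ , b⊈c , _) = ⊥-elim (b⊈c b⊆c)

  insertion-wedge : ∀ {S} → ¬ S ∈F F → WedgeUnder S ⊎ WedgeBeside S
  insertion-wedge {S} S∉F = wedge-in-insert (back b∈F) (back c∈F) (back d∈F) (proj₂ (proj₂ shape))
    where
    back : ∀ {s} → s ∈F insert S F → s ≡ S ⊎ s ∈F F
    back = ∈-insert⁻ {S = S} {F}
    open DiamondIn (induced⇒diamond {F = insert S F}
      (proj₂ saturated (insert S F) (⊆-insert {S = S}) (S , ∈-insert-new {S = S} {F} , S∉F)))

  wedge-beside : ∀ {S m} → ¬ S ∈F F → S ⊆ m → m ∈F F → WedgeBeside S
  wedge-beside S∉F S⊆m m∈F with insertion-wedge S∉F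
  ... | inj₁ (_ , _ , b∈F , c∈F , b⊆S , c⊆S , b⊥c) =
    ⊥-elim (no-wedge b∈F c∈F m∈F (⊆-trans b⊆S S⊆m , ⊆-trans c⊆S S⊆m , b⊥c))
  ... | inj₂ beside = beside

  covered : ∀ i → ∃ λ t → t ∈F F × i ∈ t
  covered i with ⁅ i ⁆ ∈F? F
  ... | yes i∈F = ⁅ i ⁆ , i∈F , x∈⁅x⁆ i
  ... | no i∉F with insertion-wedge i∉F
  ...   | inj₁ (_ , _ , _ , _ , b⊆i , c⊆i , b⊈c , c⊈b) =
    ⊥-elim ([ b⊈c , c⊈b ]′ (⊆⁅⁆-total b⊆i c⊆i))
  ...   | inj₂ (_ , t , _ , t∈F , i⊆t , _) = t , t∈F , i⊆t (x∈⁅x⁆ i)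

  StrictlyBelow : Subset n → Subset n → Set
  StrictlyBelow m y = y ∈F F × y ⊊ m

  strictlyBelow? : ∀ m → Decidable (StrictlyBelow m)
  strictlyBelow? m y = (y ∈F? F) ×-dec (y ⊊? m)

  depth : Subset n → ℕ
  depth m = length (filter (strictlyBelow? m) (allSubsets n))

  depth-mono : ∀ {m m'} → (∀ {y} → StrictlyBelow m y → StrictlyBelow m' y) → depth m ≤ depth m'
  depth-mono below⇒below =
    length-filter-mono (strictlyBelow? _) (strictlyBelow? _) below⇒below (allSubsets n)

  depth-< : ∀ {a m} → a ∈F F → a ⊊ m → depth a < depth m
  depth-< {a} a∈F a⊊m =
    length-filter-mono-< (strictlyBelow? a) (strictlyBelow? _)
      (λ (y∈F , y⊊a) → y∈F , ⊆-⊊-trans (proj₁ y⊊a) a⊊m)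
      (allSubsets-complete a) (a∈F , a⊊m) (λ (_ , _ , a≢a) → a≢a refl)

  greatest-below : ∀ {m} → m ∈F F → ⊥ ⊊ m →
                   Σ (Subset n) λ p → StrictlyBelow m p × (∀ {x} → StrictlyBelow m x → x ⊆ p)
  greatest-below {m} m∈F ⊥⊊m
    with p , p-below@(p∈F , p⊊m) , p-deepest ←
         maximiser allSubsets-complete depth (strictlyBelow? m) (⊥ , ⊥∈F , ⊥⊊m)
    = p , p-below , below-p
    where
    below-p : ∀ {x} → StrictlyBelow m x → x ⊆ p
    below-p {x} x-below@(x∈F , x⊊m) with comparable-below x∈F p∈F m∈F (proj₁ x⊊m) (proj₁ p⊊m)
    ... | inj₁ x⊆p = x⊆p
    ... | inj₂ p⊆x with p ≟ˢ x
    ...   | yes refl = ⊆-refl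
    ...   | no p≢x = contradiction (p-deepest x x-below) (<⇒≱ (depth-< p∈F (p⊆x , p≢x)))

  MinimalWith : Fin n → Subset n → Set
  MinimalWith i m = m ∈F F × i ∈ m × ¬ (∃ λ y → StrictlyBelow m y × i ∈ y)

  minimalWith? : ∀ i → Decidable (MinimalWith i)
  minimalWith? i m =
    (m ∈F? F) ×-dec (i ∈? m) ×-dec ¬? (anySubset? λ y → strictlyBelow? m y ×-dec (i ∈? y))

  minimal-below : ∀ {i t} → t ∈F F → i ∈ t → ∃ λ m → MinimalWith i m × m ⊆ t
  minimal-below {i} {t} t∈F i∈t
    with m , (m∈F , m⊆t , i∈m) , m-shallowest ←
         minimiser allSubsets-complete depth (λ y → (y ∈F? F) ×-dec (y ⊆? t) ×-dec (i ∈? y))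
                   (t , t∈F , ⊆-refl , i∈t)
    = m , (m∈F , i∈m , shallower-absurd) , m⊆t
    where
    shallower-absurd : ¬ (∃ λ y → StrictlyBelow m y × i ∈ y)
    shallower-absurd (y , (y∈F , y⊊m) , i∈y) =
      <⇒≱ (depth-< y∈F y⊊m) (m-shallowest y (y∈F , ⊆-trans (proj₁ y⊊m) m⊆t , i∈y))

  deepest-minimal : ∀ i → Σ (Subset n) λ m →
                    MinimalWith i m × (∀ m' → MinimalWith i m' → depth m' ≤ depth m)
  deepest-minimal i =
    let t , t∈F , i∈t = covered i
        m , m-minimal , _ = minimal-below t∈F i∈t
    in maximiser allSubsets-complete depth (minimalWith? i) (m , m-minimal)

  deeper-minimal : ∀ {i m p} → (∀ {x} → StrictlyBelow m x → x ⊆ p) → p ∈F F →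
                   WedgeBeside (p ∪ ⁅ i ⁆) → ∃ λ m' → MinimalWith i m' × depth m < depth m'
  deeper-minimal {i} {m} {p} below-p p∈F (e , t , e∈F , t∈F , S⊆t , e⊆t , S⊈e , e⊈S)
    with m' , m'-minimal@(m'∈F , i∈m' , _) , m'⊆t ← minimal-below t∈F (S⊆t (x∈p∪⁅x⁆ p i))
    = m' , m'-minimal , ≤-<-trans (depth-mono below-m⇒below-e) (depth-< e∈F e⊊m')
    where
    p⊊e : p ⊊ e
    p⊊e with comparable-below e∈F p∈F t∈F e⊆t (⊆-trans (p⊆p∪q ⁅ i ⁆) S⊆t)
    ... | inj₁ e⊆p = ⊥-elim (e⊈S (⊆-trans e⊆p (p⊆p∪q ⁅ i ⁆)))
    ... | inj₂ p⊆e = p⊆e , λ { refl → e⊈S (p⊆p∪q ⁅ i ⁆) }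
    i∉e : i ∉ e
    i∉e i∈e = S⊈e (p∪⁅x⁆-least (proj₁ p⊊e) i∈e)
    e⊊m' : e ⊊ m'
    e⊊m' with comparable-below m'∈F e∈F t∈F m'⊆t e⊆t
    ... | inj₁ m'⊆e = ⊥-elim (i∉e (m'⊆e i∈m'))
    ... | inj₂ e⊆m' = e⊆m' , λ { refl → i∉e i∈m' }
    below-m⇒below-e : ∀ {x} → StrictlyBelow m x → StrictlyBelow e x
    below-m⇒below-e x-below@(x∈F , _) = x∈F , ⊆-⊊-trans (below-p x-below) p⊊e

  shared-minimal-not-deepest : ∀ {i j m} → i ≢ j → MinimalWith i m → MinimalWith j m →
                               ∃ λ m' → MinimalWith i m' × depth m < depth m'
  shared-minimal-not-deepest {i} {j} {m} i≢j (m∈F , i∈m , i-minimal) (_ , j∈m , j-minimal)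
    with p , p-below@(p∈F , p⊊m) , below-p ←
         greatest-below m∈F (⊥⊆ , λ ⊥≡m → ∉⊥ (subst (i ∈_) (sym ⊥≡m) i∈m))
    = deeper-minimal below-p p∈F (wedge-beside S∉F (proj₁ S⊊m) m∈F)
    where
    S⊊m : p ∪ ⁅ i ⁆ ⊊ m
    S⊊m = p∪⁅x⁆-least (proj₁ p⊊m) i∈m ,
          λ S≡m → y∉p∪⁅x⁆ (λ j∈p → j-minimal (p , p-below , j∈p)) (i≢j ∘ sym)
                           (subst (j ∈_) (sym S≡m) j∈m)
    S∉F : ¬ (p ∪ ⁅ i ⁆) ∈F F
    S∉F S∈F = i-minimal (p ∪ ⁅ i ⁆ , (S∈F , S⊊m) , x∈p∪⁅x⁆ p i)

  deepest : Fin n → Subset n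
  deepest i = proj₁ (deepest-minimal i)

  deepest-injective : Injective _≡_ _≡_ deepest
  deepest-injective {i} {j} mᵢ≡mⱼ with i ≟ᶠ j
  ... | yes i≡j = i≡j
  ... | no i≢j =
    let _ , mᵢ-minimal , mᵢ-deepest = deepest-minimal i
        _ , mⱼ-minimal , _ = deepest-minimal j
        m' , m'-minimal , deeper =
          shared-minimal-not-deepest i≢j mᵢ-minimal (subst (MinimalWith j) (sym mᵢ≡mⱼ) mⱼ-minimal)
    in contradiction (mᵢ-deepest m' m'-minimal) (<⇒≱ deeper)

  embedding : suc n ↪ F
  embedding = h , h∈F , h-injective
    where
    h : Fin (suc n) → Subset n
    h zero = ⊥
    h (suc i) = deepest i
    h∈F : ∀ x → h x ∈F F
    h∈F zero = ⊥∈F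
    h∈F (suc i) = let _ , (mᵢ∈F , _) , _ = deepest-minimal i in mᵢ∈F
    i∈deepest : ∀ i → i ∈ deepest i
    i∈deepest i = let _ , (_ , i∈mᵢ , _) , _ = deepest-minimal i in i∈mᵢ
    h-injective : Injective _≡_ _≡_ h
    h-injective {zero} {zero} _ = refl
    h-injective {zero} {suc j} ⊥≡mⱼ = ⊥-elim (∉⊥ (subst (j ∈_) (sym ⊥≡mⱼ) (i∈deepest j)))
    h-injective {suc i} {zero} mᵢ≡⊥ = ⊥-elim (∉⊥ (subst (i ∈_) mᵢ≡⊥ (i∈deepest i)))
    h-injective {suc i} {suc j} mᵢ≡mⱼ = cong suc (deepest-injective mᵢ≡mⱼ)

lemma15 : (n : ℕ) → 2 ≤ n → (F : Family n) → InducedD₂Saturated F →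
    (⊥ ∈F F ⊎ ⊤ ∈F F) → n + 1 ≤ card F
lemma15 n _ F saturated ⊥∈F⊎⊤∈F =
  subst (_≤ card F) (+-comm 1 n) (↪⇒≤card (embedding ⊥∈F⊎⊤∈F))
  where
  embedding : ⊥ ∈F F ⊎ ⊤ ∈F F → suc n ↪ F
  embedding (inj₁ ⊥∈F) = WithEmptySet.embedding ⊥∈F saturated
  embedding (inj₂ ⊤∈F) = ↪-∁ {F = F} (WithEmptySet.embedding ⊥∈∁F (∁-saturated saturated))
    where
    ⊥∈∁F : ⊥ ∈F (F ∘ ∁)
    ⊥∈∁F = subst (_∈F F) (sym ∁⊥≡⊤) ⊤∈F
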